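{- Let $P(x,y)$ be a symmetric polynomial with integer coefficients, let $\mathbf{e}=(e_0,\dots,e_k)$ be a vector of nonnegative integers, and let $T$ be a word over $\{\mathsf{Z},\mathsf{O},\mathsf{M}\}$. Then $\mathfrak{S}^{\mathbf{e}}_T(P)$ is an integer whose $2$-adic valuation is at least $\alpha_{\mathsf{M}}(T)$ (i.e. $2^{\alpha_{\mathsf{M}}(T)}$ divides $\mathfrak{S}^{\mathbf{e}}_T(P)$).
   Context: $\Theta_2(z)$ is the odd part of a positive integer $z$. For a word $T$ of length $L$ over $\{\mathsf{Z},\mathsf{O},\mathsf{M}\}$, the pairs "of type $T$" are the ordered pairs $(x,y)$ of integers with $0\le x,y<2^L$ such that, writing $x,y$ in binary with exactly $L$ digits (leading zeroes allowed) as the two rows of a $2\times L$ matrix, the $j$-th column contains two $0$s, two $1$s, or one of each, according as the $j$-th letter of $T$ is $\mathsf{Z}$, $\mathsf{O}$, or $\mathsf{M}$; for the empty word the only pair is $(0,0)$. $\mathfrak{S}^{\mathbf{e}}_T(P)=\sum P(x,y)\prod_{i=0}^k\big(\Theta_2((2^ix)!)\,\Theta_2((2^iy)!)\big)^{e_i}$ over all pairs of type $T$. $\alpha_{\mathsf{M}}(T)$ is the number of occurrences of the letter $\mathsf{M}$ in $T$. -}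

module Defs where

open import Data.Nat as ℕ using (ℕ; zero; suc; _!; _^_; _/_; _%_; _≡ᵇ_)
open import Data.Bool using (Bool; true; false; _∧_; if_then_else_)
open import Data.Integer as ℤ using (ℤ; +_)
open import Data.List as List using (List; []; _∷_; length; filter; map; concatMap; upTo; sum; foldr)
open import Data.Vec as Vec using (Vec)
open import Data.Product using (_×_; _,_; proj₁; proj₂)
open import Relation.Binary.PropositionalEquality using (_≡_)
open import Relation.Nullary.Decidable using (Dec)
open import Data.Bool.Properties using (T?)

-- Odd part Θ₂(z) of a natural number: divide out all factors of 2.
-- (Θ₂ 0 = 0 by convention; only positive arguments occur below.)

oddPartAux : ℕ → ℕ → ℕ
oddPartAux zero    n = n
oddPartAux (suc f) zero = zero
oddPartAux (suc f) (suc n) =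
  if (suc n % 2) ≡ᵇ 0 then oddPartAux f (suc n / 2) else suc n

Θ₂ : ℕ → ℕ
Θ₂ n = oddPartAux n n

-- Bivariate integer polynomials, as finite lists of monomials
-- c · x^i · y^j  represented by (c , i , j).

Poly : Set
Poly = List (ℤ × ℕ × ℕ)

coeff : Poly → ℕ → ℕ → ℤ
coeff [] i j = ℤ.0ℤ
coeff ((c , a , b) ∷ P) i j =
  (if (a ≡ᵇ i) ∧ (b ≡ᵇ j) then c else ℤ.0ℤ) ℤ.+ coeff P i j

Symmetric : Poly → Set
Symmetric P = ∀ i j → coeff P i j ≡ coeff P j i

eval : Poly → ℤ → ℤ → ℤ
eval [] x y = ℤ.0ℤ
eval ((c , a , b) ∷ P) x y = c ℤ.* (x ℤ.^ a) ℤ.* (y ℤ.^ b) ℤ.+ eval P x y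

data Letter : Set where
  Z O M : Letter

Word : Set
Word = List Letter

bit : ℕ → ℕ → ℕ
bit n zero = n % 2
bit n (suc i) = bit (n / 2) i

letterOK : Letter → ℕ → ℕ → Bool
letterOK Z a b = (a ≡ᵇ 0) ∧ (b ≡ᵇ 0)
letterOK O a b = (a ≡ᵇ 1) ∧ (b ≡ᵇ 1)
letterOK M a b = (a ℕ.+ b) ≡ᵇ 1

-- x, y written with exactly L = length T digits; the j-th letter of T
-- (from the left) governs the j-th column, i.e. digit of weight 2^(L-1-j).
hasType : Word → ℕ → ℕ → Bool
hasType [] x y = true
hasType (l ∷ T) x y = letterOK l (bit x (length T)) (bit y (length T)) ∧ hasType T x y

allPairs : ℕ → List (ℕ × ℕ)
allPairs L = concatMap (λ x → map (λ y → (x , y)) (upTo (2 ^ L))) (upTo (2 ^ L))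

pairsOfType : Word → List (ℕ × ℕ)
pairsOfType T = filter (λ p → T? (hasType T (proj₁ p) (proj₂ p)))
                       (allPairs (length T))

countM : Word → ℕ
countM [] = 0
countM (M ∷ T) = suc (countM T)
countM (_ ∷ T) = countM T

weightFrom : ∀ {n} → ℕ → Vec ℕ n → ℕ → ℕ → ℕ
weightFrom i Vec.[] x y = 1
weightFrom i (eᵢ Vec.∷ e) x y =
  ((Θ₂ ((2 ^ i ℕ.* x) !) ℕ.* Θ₂ ((2 ^ i ℕ.* y) !)) ^ eᵢ) ℕ.* weightFrom (suc i) e x y

weight : ∀ {n} → Vec ℕ n → ℕ → ℕ → ℕ
weight e = weightFrom 0 e

𝔖 : ∀ {n} → Vec ℕ n → Word → Poly → ℤ
𝔖 e T P = List.foldr ℤ._+_ ℤ.0ℤ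
  (map (λ p → eval P (+ proj₁ p) (+ proj₂ p) ℤ.* + weight e (proj₁ p) (proj₂ p))
       (pairsOfType T))

-- Write W(x) for ∏ᵢ Θ₂((2ⁱx)!)^eᵢ, so that the summand is P(x,y) W(x) W(y), and peel off the
-- last letter of T, i.e. the lowest binary digit: x = 2x′ + a, y = 2y′ + b. With the exponents
-- shifted by one level, W(2x′) = W′(x′) and W(2x′+1) = W′(x′) φ(x′), where φ is a product of odd
-- parts Θ₂(2^(i+1) x′ + 2^v (2j+1)) = (2j+1) + 2^(i+1-v) x′, hence a polynomial congruent to a
-- constant mod 2. For the letters Z and O the sum keeps its shape, over the shorter word and with a
-- new symmetric polynomial. For M the cells (2x′, 2y′+1) and (2x′+1, 2y′) contribute equally by
-- symmetry, which produces the factor 2; the remaining sum has a polynomial congruent to a constant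
-- mod 2, whose constant part is symmetric and whose even part reduces to a symmetric sum by
-- symmetrisation.

module Submission where

open import Defs
open import Data.Nat using (ℕ; suc; _^_)
open import Data.Integer using (+_)
open import Data.Integer.Divisibility using (_∣_)
open import Data.Vec using (Vec; []; _∷_)
open import Data.Product using (∃; ∃₂; _×_; _,_; proj₁; proj₂; uncurry)
open import Function using (id; _∘_)
open import Relation.Binary.PropositionalEquality
  using (_≡_; refl; sym; trans; cong; cong₂; subst; subst₂; module ≡-Reasoning)

module OddPart where
  open import Data.Nat using (zero; _!; _+_; _*_; _%_; _/_; _≤_; _<_; z≤n; s≤s; _∸_; NonZero)
  open import Data.Nat.Properties
  open import Data.Nat.DivMod
  open import Data.Nat.Divisibility using (n∣m*n)
  open import Data.Nat.Induction using (<-rec)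
  open import Data.Nat.Tactic.RingSolver using (solve-∀)
  open import Data.Sum using (_⊎_; inj₁; inj₂)
  open import Algebra.Properties.CommutativeSemigroup *-commutativeSemigroup
    using (interchange; x∙yz≈y∙xz)

  double%2 : ∀ n → 2 * n % 2 ≡ 0
  double%2 n = trans (cong (_% 2) (*-comm 2 n)) (m*n%n≡0 n 2)

  double+1%2 : ∀ n → suc (2 * n) % 2 ≡ 1
  double+1%2 n = trans (cong (λ m → suc m % 2) (*-comm 2 n)) ([m+kn]%n≡m%n 1 n 2)

  double/2 : ∀ n → 2 * n / 2 ≡ n
  double/2 n = trans (/-congˡ (*-comm 2 n)) (m*n/n≡m n 2)

  double+1/2 : ∀ n → suc (2 * n) / 2 ≡ n
  double+1/2 n = trans (/-congˡ {o = 2} (cong suc (*-comm 2 n)))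
                       (trans (+-distrib-/-∣ʳ 1 {d = 2} (n∣m*n n)) (m*n/n≡m n 2))

  digit-%2 : ∀ a x → a < 2 → (a + 2 * x) % 2 ≡ a
  digit-%2 zero          x _ = double%2 x
  digit-%2 (suc zero)    x _ = double+1%2 x
  digit-%2 (suc (suc a)) x (s≤s (s≤s ()))

  digit-/2 : ∀ a x → a < 2 → (a + 2 * x) / 2 ≡ x
  digit-/2 zero          x _ = double/2 x
  digit-/2 (suc zero)    x _ = double+1/2 x
  digit-/2 (suc (suc a)) x (s≤s (s≤s ()))

  parity : ∀ n → ∃ λ m → n ≡ 2 * m ⊎ n ≡ suc (2 * m)
  parity zero = 0 , inj₁ refl
  parity (suc n) with parity n
  ... | m , inj₁ refl = m , inj₂ refl
  ... | m , inj₂ refl = suc m , inj₁ (sym (*-suc 2 m))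

  2^v*odd-decomposition : ∀ n → ∃₂ λ v j → suc n ≡ 2 ^ v * suc (2 * j)
  2^v*odd-decomposition = <-rec _ decompose
    where
    decompose : ∀ n → (∀ {m} → m < n → ∃₂ λ v j → suc m ≡ 2 ^ v * suc (2 * j)) →
                ∃₂ λ v j → suc n ≡ 2 ^ v * suc (2 * j)
    decompose n rec with parity (suc n)
    ... | j , inj₂ eq = 0 , j , trans eq (sym (*-identityˡ _))
    ... | suc m , inj₁ eq with rec {m} (m<n)
      where
      m<n : m < n
      m<n = ≤-trans (s≤s (m≤n*m m 2)) (≤-reflexive (sym (suc-injective (trans eq (*-suc 2 m)))))
    ... | v , j , eq′ = suc v , j , trans eq (trans (cong (2 *_) eq′) (sym (*-assoc 2 (2 ^ v) _)))

  ^-distribʳ-* : ∀ m n o → (m * n) ^ o ≡ m ^ o * n ^ o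
  ^-distribʳ-* m n zero    = refl
  ^-distribʳ-* m n (suc o) = trans (cong (m * n *_) (^-distribʳ-* m n o)) (interchange m n (m ^ o) (n ^ o))

  oddPartAux-zero : ∀ f → oddPartAux f 0 ≡ 0
  oddPartAux-zero zero = refl
  oddPartAux-zero (suc f) = refl

  oddPartAux-odd : ∀ f j → oddPartAux f (suc (2 * j)) ≡ suc (2 * j)
  oddPartAux-odd zero j = refl
  oddPartAux-odd (suc f) j rewrite double+1%2 j = refl

  oddPartAux-double : ∀ f n → oddPartAux (suc f) (2 * suc n) ≡ oddPartAux f (suc n)
  oddPartAux-double f n rewrite double%2 (suc n) = cong (oddPartAux f) (double/2 (suc n))

  oddPartAux-2^v*odd : ∀ v j f → v ≤ f → oddPartAux f (2 ^ v * suc (2 * j)) ≡ suc (2 * j)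
  oddPartAux-2^v*odd zero j f _ rewrite *-identityˡ (suc (2 * j)) = oddPartAux-odd f j
  oddPartAux-2^v*odd (suc v) j (suc f) (s≤s v≤f)
    rewrite *-assoc 2 (2 ^ v) (suc (2 * j))
    with 2 ^ v * suc (2 * j) | oddPartAux-2^v*odd v j f v≤f
  ... | zero  | eq with () ← trans (sym eq) (oddPartAux-zero f)
  ... | suc n | eq = trans (oddPartAux-double f n) eq

  n<2^n : ∀ n → n < 2 ^ n
  n<2^n zero = s≤s z≤n
  n<2^n (suc n) = begin-strict
    suc n            <⟨ +-mono-≤ (m^n>0 2 n) (n<2^n n) ⟩
    2 ^ n + 2 ^ n    ≡⟨ cong (_+_ (2 ^ n)) (sym (+-identityʳ (2 ^ n))) ⟩
    2 ^ suc n        ∎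
    where open ≤-Reasoning

  Θ₂-2^v*odd : ∀ v j → Θ₂ (2 ^ v * suc (2 * j)) ≡ suc (2 * j)
  Θ₂-2^v*odd v j = oddPartAux-2^v*odd v j _ (≤-trans (<⇒≤ (n<2^n v)) (m≤m*n (2 ^ v) (suc (2 * j))))

  Θ₂-* : ∀ m n .{{_ : NonZero m}} .{{_ : NonZero n}} → Θ₂ (m * n) ≡ Θ₂ m * Θ₂ n
  Θ₂-* (suc m) (suc n) with 2^v*odd-decomposition m | 2^v*odd-decomposition n
  ... | v , i , m≡ | w , j , n≡ = begin
    Θ₂ (suc m * suc n)                                    ≡⟨ cong Θ₂ (cong₂ _*_ m≡ n≡) ⟩
    Θ₂ (2 ^ v * suc (2 * i) * (2 ^ w * suc (2 * j)))      ≡⟨ cong Θ₂ regroup ⟩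
    Θ₂ (2 ^ (v + w) * suc (2 * (i + j + 2 * i * j)))      ≡⟨ Θ₂-2^v*odd (v + w) (i + j + 2 * i * j) ⟩
    suc (2 * (i + j + 2 * i * j))                          ≡⟨ odd*odd i j ⟨
    suc (2 * i) * suc (2 * j)                              ≡⟨ cong₂ _*_ (Θ₂-2^v*odd v i) (Θ₂-2^v*odd w j) ⟨
    Θ₂ (2 ^ v * suc (2 * i)) * Θ₂ (2 ^ w * suc (2 * j))   ≡⟨ cong₂ _*_ (cong Θ₂ m≡) (cong Θ₂ n≡) ⟨
    Θ₂ (suc m) * Θ₂ (suc n)                                ∎
    where
    open ≡-Reasoning
    odd*odd : ∀ i j → suc (2 * i) * suc (2 * j) ≡ suc (2 * (i + j + 2 * i * j))
    odd*odd = solve-∀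
    regroup : 2 ^ v * suc (2 * i) * (2 ^ w * suc (2 * j)) ≡ 2 ^ (v + w) * suc (2 * (i + j + 2 * i * j))
    regroup = trans (interchange (2 ^ v) _ (2 ^ w) _)
                    (cong₂ _*_ (sym (^-distribˡ-+-* 2 v w)) (odd*odd i j))

  oddPartProduct : ℕ → ℕ → ℕ
  oddPartProduct N zero = 1
  oddPartProduct N (suc t) = Θ₂ (suc (N + t)) * oddPartProduct N t

  Θ₂-!-+ : ∀ N t → Θ₂ ((N + t) !) ≡ Θ₂ (N !) * oddPartProduct N t
  Θ₂-!-+ N zero = trans (cong (λ m → Θ₂ (m !)) (+-identityʳ N)) (sym (*-identityʳ _))
  Θ₂-!-+ N (suc t) = begin
    Θ₂ ((N + suc t) !)                                   ≡⟨ cong (λ m → Θ₂ (m !)) (+-suc N t) ⟩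
    Θ₂ (suc (N + t) * (N + t) !)
      ≡⟨ Θ₂-* (suc (N + t)) ((N + t) !) {{_}} {{(N + t) !≢0}} ⟩
    Θ₂ (suc (N + t)) * Θ₂ ((N + t) !)                    ≡⟨ cong (Θ₂ (suc (N + t)) *_) (Θ₂-!-+ N t) ⟩
    Θ₂ (suc (N + t)) * (Θ₂ (N !) * oddPartProduct N t)
      ≡⟨ x∙yz≈y∙xz (Θ₂ (suc (N + t))) (Θ₂ (N !)) _ ⟩
    Θ₂ (N !) * oddPartProduct N (suc t)                  ∎
    where open ≡-Reasoning

  Θ₂-offset : ∀ k s → suc s ≤ 2 ^ k →
              ∃₂ λ r j → ∀ x → Θ₂ (suc (2 ^ suc k * x + s)) ≡ suc (2 * j) + 2 * (2 ^ r * x)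
  Θ₂-offset k s s<2^k with 2^v*odd-decomposition s
  ... | v , j , s≡ = r , j , λ x → begin
    Θ₂ (suc (2 ^ suc k * x + s))             ≡⟨ cong Θ₂ (split x) ⟩
    Θ₂ (2 ^ v * suc (2 * (2 ^ r * x + j)))   ≡⟨ Θ₂-2^v*odd v (2 ^ r * x + j) ⟩
    suc (2 * (2 ^ r * x + j))                ≡⟨ odd-shift (2 ^ r * x) j ⟩
    suc (2 * j) + 2 * (2 ^ r * x)            ∎
    where
    open ≡-Reasoning
    v≤k : v ≤ k
    v≤k = ≮⇒≥ λ k<v → <⇒≱ (^-monoʳ-< 2 (s≤s (s≤s z≤n)) k<v)
            (≤-trans (m≤m*n (2 ^ v) (suc (2 * j))) (≤-trans (≤-reflexive (sym s≡)) s<2^k))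
    r = k ∸ v
    2^k≡ : 2 ^ k ≡ 2 ^ v * 2 ^ r
    2^k≡ = trans (cong (2 ^_) (sym (m+[n∸m]≡n v≤k))) (^-distribˡ-+-* 2 v r)
    odd-shift : ∀ y j → suc (2 * (y + j)) ≡ suc (2 * j) + 2 * y
    odd-shift = solve-∀
    factor : ∀ p q x j → 2 * (p * q) * x + p * suc (2 * j) ≡ p * suc (2 * (q * x + j))
    factor = solve-∀
    split : ∀ x → suc (2 ^ suc k * x + s) ≡ 2 ^ v * suc (2 * (2 ^ r * x + j))
    split x = trans (sym (+-suc _ s))
                    (trans (cong₂ (λ a b → 2 * a * x + b) 2^k≡ s≡) (factor (2 ^ v) (2 ^ r) x j))

  weight₁ : ∀ {n} → ℕ → Vec ℕ n → ℕ → ℕ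
  weight₁ i []      x = 1
  weight₁ i (a ∷ e) x = Θ₂ ((2 ^ i * x) !) ^ a * weight₁ (suc i) e x

  oddRatio : ∀ {n} → ℕ → Vec ℕ n → ℕ → ℕ
  oddRatio i []      x = 1
  oddRatio i (a ∷ e) x = oddPartProduct (2 ^ suc i * x) (2 ^ i) ^ a * oddRatio (suc i) e x

  weightFrom-split : ∀ {n} i (e : Vec ℕ n) x y → weightFrom i e x y ≡ weight₁ i e x * weight₁ i e y
  weightFrom-split i []      x y = refl
  weightFrom-split i (a ∷ e) x y = begin
    (Θ₂ ((2 ^ i * x) !) * Θ₂ ((2 ^ i * y) !)) ^ a * weightFrom (suc i) e x y
      ≡⟨ cong₂ _*_ (^-distribʳ-* (Θ₂ ((2 ^ i * x) !)) (Θ₂ ((2 ^ i * y) !)) a) (weightFrom-split (suc i) e x y) ⟩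
    Θ₂ ((2 ^ i * x) !) ^ a * Θ₂ ((2 ^ i * y) !) ^ a * (weight₁ (suc i) e x * weight₁ (suc i) e y)
      ≡⟨ interchange (Θ₂ ((2 ^ i * x) !) ^ a) _ (weight₁ (suc i) e x) _ ⟩
    weight₁ i (a ∷ e) x * weight₁ i (a ∷ e) y ∎
    where open ≡-Reasoning

  weight₁-double : ∀ {n} i (e : Vec ℕ n) x → weight₁ i e (2 * x) ≡ weight₁ (suc i) e x
  weight₁-double i []      x = refl
  weight₁-double i (a ∷ e) x =
    cong₂ (λ m w → Θ₂ (m !) ^ a * w) (*-left-comm (2 ^ i) 2 x) (weight₁-double (suc i) e x)
    where
    *-left-comm : ∀ p q x → p * (q * x) ≡ q * p * x
    *-left-comm = solve-∀

  weight₁-double+1 : ∀ {n} i (e : Vec ℕ n) x → weight₁ i e (suc (2 * x)) ≡ weight₁ (suc i) e x * oddRatio i e x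
  weight₁-double+1 i []      x = refl
  weight₁-double+1 i (a ∷ e) x = begin
    Θ₂ ((2 ^ i * suc (2 * x)) !) ^ a * weight₁ (suc i) e (suc (2 * x))
      ≡⟨ cong₂ (λ m w → Θ₂ (m !) ^ a * w) (spread (2 ^ i) x) (weight₁-double+1 (suc i) e x) ⟩
    Θ₂ ((N + 2 ^ i) !) ^ a * (weight₁ (suc (suc i)) e x * oddRatio (suc i) e x)
      ≡⟨ cong (λ m → m ^ a * (weight₁ (suc (suc i)) e x * oddRatio (suc i) e x)) (Θ₂-!-+ N (2 ^ i)) ⟩
    (Θ₂ (N !) * oddPartProduct N (2 ^ i)) ^ a * (weight₁ (suc (suc i)) e x * oddRatio (suc i) e x)
      ≡⟨ cong (_* _) (^-distribʳ-* (Θ₂ (N !)) (oddPartProduct N (2 ^ i)) a) ⟩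
    Θ₂ (N !) ^ a * oddPartProduct N (2 ^ i) ^ a * (weight₁ (suc (suc i)) e x * oddRatio (suc i) e x)
      ≡⟨ interchange (Θ₂ (N !) ^ a) _ (weight₁ (suc (suc i)) e x) _ ⟩
    weight₁ (suc i) (a ∷ e) x * oddRatio i (a ∷ e) x ∎
    where
    open ≡-Reasoning
    N = 2 ^ suc i * x
    spread : ∀ p x → p * suc (2 * x) ≡ 2 * p * x + p
    spread = solve-∀

open OddPart

import Data.Nat as ℕ
open import Data.Nat using (zero; _≡ᵇ_)
import Data.Nat.Properties as ℕ
open import Data.Integer as ℤ using (ℤ; 0ℤ; _+_; _*_)
open import Data.Integer.Properties
open import Data.Integer.Tactic.RingSolver using (solve-∀)
open import Algebra.Properties.CommutativeSemigroup +-commutativeSemigroup using ()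
  renaming (interchange to +-interchange)
open import Algebra.Properties.CommutativeSemigroup *-commutativeSemigroup using ()
  renaming (xy∙z≈xz∙y to *-right-comm)
open import Data.Integer.Divisibility.Signed using (divides; ∣⇒∣ᵤ; ∣m∣n⇒∣m+n; *-monoʳ-∣)
  renaming (_∣_ to _∣ₛ_)
open import Data.Bool using (Bool; true; false; if_then_else_; _∧_)
open import Data.Bool.Properties using (∧-comm; ∧-assoc; ∧-identityʳ; T?)
open import Data.List using (List; []; _∷_; _++_; _∷ʳ_; length; map; foldr; filter; concatMap; applyUpTo; upTo)
open import Data.List.Properties using (length-++; map-++; map-∘)
open import Data.List.Reverse using (Reverse; []; _∶_∶ʳ_; reverseView)

-- Finite sums

∑< : ℕ → (ℕ → ℤ) → ℤ
∑< zero    h = 0ℤ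
∑< (suc n) h = h 0 + ∑< n (h ∘ suc)

syntax ∑< n (λ i → t) = ∑[ i < n ] t

∑-cong : ∀ n {g h : ℕ → ℤ} → (∀ i → g i ≡ h i) → ∑< n g ≡ ∑< n h
∑-cong zero    g≗h = refl
∑-cong (suc n) g≗h = cong₂ _+_ (g≗h 0) (∑-cong n (g≗h ∘ suc))

∑-zero : ∀ n → ∑[ i < n ] 0ℤ ≡ 0ℤ
∑-zero zero    = refl
∑-zero (suc n) = trans (+-identityˡ _) (∑-zero n)

∑-distrib-+ : ∀ n (g h : ℕ → ℤ) → ∑[ i < n ] (g i + h i) ≡ ∑< n g + ∑< n h
∑-distrib-+ zero    g h = refl
∑-distrib-+ (suc n) g h =
  trans (cong (_+_ (g 0 + h 0)) (∑-distrib-+ n (g ∘ suc) (h ∘ suc))) (+-interchange (g 0) (h 0) _ _)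

∑-distribˡ-* : ∀ n c (h : ℕ → ℤ) → ∑[ i < n ] (c * h i) ≡ c * ∑< n h
∑-distribˡ-* zero    c h = sym (*-zeroʳ c)
∑-distribˡ-* (suc n) c h =
  trans (cong (_+_ (c * h 0)) (∑-distribˡ-* n c (h ∘ suc))) (sym (*-distribˡ-+ c (h 0) _))

∑-comm : ∀ m n (f : ℕ → ℕ → ℤ) → ∑[ i < m ] ∑[ j < n ] f i j ≡ ∑[ j < n ] ∑[ i < m ] f i j
∑-comm zero    n f = sym (∑-zero n)
∑-comm (suc m) n f =
  trans (cong (_+_ (∑< n (f 0))) (∑-comm m n (f ∘ suc))) (sym (∑-distrib-+ n (f 0) _))

∑-double : ∀ n (h : ℕ → ℤ) → ∑< (2 ℕ.* n) h ≡ ∑[ i < n ] (h (2 ℕ.* i) + h (suc (2 ℕ.* i)))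
∑-double zero    h = refl
∑-double (suc n) h = begin
  ∑< (2 ℕ.* suc n) h                                       ≡⟨ cong (λ m → ∑< m h) (ℕ.*-suc 2 n) ⟩
  h 0 + (h 1 + ∑< (2 ℕ.* n) (h ∘ suc ∘ suc))               ≡⟨ +-assoc (h 0) (h 1) _ ⟨
  h 0 + h 1 + ∑< (2 ℕ.* n) (h ∘ suc ∘ suc)
    ≡⟨ cong (_+_ (h 0 + h 1)) (∑-double n (h ∘ suc ∘ suc)) ⟩
  h 0 + h 1 + ∑[ i < n ] (h (2 ℕ.+ 2 ℕ.* i) + h (3 ℕ.+ 2 ℕ.* i))
    ≡⟨ cong (_+_ (h 0 + h 1)) (∑-cong n λ i → cong (λ m → h m + h (suc m)) (sym (ℕ.*-suc 2 i))) ⟩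
  ∑[ i < suc n ] (h (2 ℕ.* i) + h (suc (2 ℕ.* i)))         ∎
  where open ≡-Reasoning

∑-indicator : ∀ D a c (f : ℕ → ℤ) → a ℕ.< D →
              ∑[ i < D ] ((if a ≡ᵇ i then c else 0ℤ) * f i) ≡ c * f a
∑-indicator (suc D) zero    c f _ =
  trans (cong (_+_ (c * f 0)) (trans (∑-cong D λ i → *-zeroˡ (f (suc i))) (∑-zero D))) (+-identityʳ _)
∑-indicator (suc D) (suc a) c f (ℕ.s≤s a<D) = trans (+-identityˡ _) (∑-indicator D a c (f ∘ suc) a<D)

-- Polynomial functions

infixl 6 _+ₚ_
infixl 7 _*ₚ_

data Polynomial : (ℕ → ℕ → ℤ) → Set where
  const : ∀ c → Polynomial (λ _ _ → c)
  varˣ  : Polynomial (λ x _ → + x)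
  varʸ  : Polynomial (λ _ y → + y)
  _+ₚ_  : ∀ {f g} → Polynomial f → Polynomial g → Polynomial (λ x y → f x y + g x y)
  _*ₚ_  : ∀ {f g} → Polynomial f → Polynomial g → Polynomial (λ x y → f x y * g x y)
  resp  : ∀ {f g} → (∀ x y → f x y ≡ g x y) → Polynomial f → Polynomial g

Polynomial-swap : ∀ {f} → Polynomial f → Polynomial (λ x y → f y x)
Polynomial-swap (const c)    = const c
Polynomial-swap varˣ         = varʸ
Polynomial-swap varʸ         = varˣ
Polynomial-swap (p +ₚ q)     = Polynomial-swap p +ₚ Polynomial-swap q
Polynomial-swap (p *ₚ q)     = Polynomial-swap p *ₚ Polynomial-swap q
Polynomial-swap (resp f≗g p) = resp (λ x y → f≗g y x) (Polynomial-swap p)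

record ConstantMod2 (f : ℕ → ℕ → ℤ) : Set where
  field
    constant            : ℤ
    quotient            : ℕ → ℕ → ℤ
    quotient-polynomial : Polynomial quotient
    decomposition       : ∀ x y → f x y ≡ constant + + 2 * quotient x y

open ConstantMod2

ConstantMod2⇒Polynomial : ∀ {f} → ConstantMod2 f → Polynomial f
ConstantMod2⇒Polynomial f≡ =
  resp (λ x y → sym (decomposition f≡ x y)) (const (constant f≡) +ₚ const (+ 2) *ₚ quotient-polynomial f≡)

ConstantMod2-resp : ∀ {f g} → (∀ x y → f x y ≡ g x y) → ConstantMod2 f → ConstantMod2 g
ConstantMod2-resp f≗g f≡ = record
  { constant = constant f≡ ; quotient = quotient f≡ ; quotient-polynomial = quotient-polynomial f≡
  ; decomposition = λ x y → trans (sym (f≗g x y)) (decomposition f≡ x y) }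

ConstantMod2-const : ∀ c → ConstantMod2 (λ _ _ → c)
ConstantMod2-const c = record
  { constant = c ; quotient = λ _ _ → 0ℤ ; quotient-polynomial = const 0ℤ
  ; decomposition = λ _ _ → sym (+-identityʳ c) }

ConstantMod2-swap : ∀ {f} → ConstantMod2 f → ConstantMod2 (λ x y → f y x)
ConstantMod2-swap f≡ = record
  { constant = constant f≡ ; quotient = λ x y → quotient f≡ y x
  ; quotient-polynomial = Polynomial-swap (quotient-polynomial f≡)
  ; decomposition = λ x y → decomposition f≡ y x }

ConstantMod2-+ : ∀ {f g} → ConstantMod2 f → ConstantMod2 g → ConstantMod2 (λ x y → f x y + g x y)
ConstantMod2-+ f≡ g≡ = record
  { constant = constant f≡ + constant g≡
  ; quotient = λ x y → quotient f≡ x y + quotient g≡ x y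
  ; quotient-polynomial = quotient-polynomial f≡ +ₚ quotient-polynomial g≡
  ; decomposition = λ x y → trans (cong₂ _+_ (decomposition f≡ x y) (decomposition g≡ x y))
                                  (regroup (constant f≡) (constant g≡) (quotient f≡ x y) (quotient g≡ x y)) }
  where
  regroup : ∀ a b p q → a + + 2 * p + (b + + 2 * q) ≡ a + b + + 2 * (p + q)
  regroup = solve-∀

ConstantMod2-* : ∀ {f g} → ConstantMod2 f → ConstantMod2 g → ConstantMod2 (λ x y → f x y * g x y)
ConstantMod2-* f≡ g≡ = record
  { constant = a * b
  ; quotient = λ x y → a * q x y + b * p x y + + 2 * p x y * q x y
  ; quotient-polynomial = const a *ₚ quotient-polynomial g≡ +ₚ const b *ₚ quotient-polynomial f≡
                          +ₚ const (+ 2) *ₚ quotient-polynomial f≡ *ₚ quotient-polynomial g≡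
  ; decomposition = λ x y → trans (cong₂ _*_ (decomposition f≡ x y) (decomposition g≡ x y))
                                  (expand a b (p x y) (q x y)) }
  where
  a = constant f≡
  b = constant g≡
  p = quotient f≡
  q = quotient g≡
  expand : ∀ a b p q → (a + + 2 * p) * (b + + 2 * q) ≡ a * b + + 2 * (a * q + b * p + + 2 * p * q)
  expand = solve-∀

Polynomial-dilate : ∀ {f} → Polynomial f → ∀ a b →
                    ConstantMod2 (λ x y → f (a ℕ.+ 2 ℕ.* x) (b ℕ.+ 2 ℕ.* y))
Polynomial-dilate (const c)    a b = ConstantMod2-const c
Polynomial-dilate varˣ         a b = record
  { constant = + a ; quotient = λ x _ → + x ; quotient-polynomial = varˣ
  ; decomposition = λ x _ → trans (pos-+ a (2 ℕ.* x)) (cong (_+_ (+ a)) (pos-* 2 x)) }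
Polynomial-dilate varʸ         a b = record
  { constant = + b ; quotient = λ _ y → + y ; quotient-polynomial = varʸ
  ; decomposition = λ _ y → trans (pos-+ b (2 ℕ.* y)) (cong (_+_ (+ b)) (pos-* 2 y)) }
Polynomial-dilate (p +ₚ q)     a b = ConstantMod2-+ (Polynomial-dilate p a b) (Polynomial-dilate q a b)
Polynomial-dilate (p *ₚ q)     a b = ConstantMod2-* (Polynomial-dilate p a b) (Polynomial-dilate q a b)
Polynomial-dilate (resp f≗g p) a b = ConstantMod2-resp (λ x y → f≗g _ _) (Polynomial-dilate p a b)

Polynomial-^ : ∀ {f} → Polynomial f → ∀ n → Polynomial (λ x y → f x y ℤ.^ n)
Polynomial-^ p zero    = const (+ 1)
Polynomial-^ p (suc n) = p *ₚ Polynomial-^ p n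

Polynomial-eval : ∀ P → Polynomial (λ x y → eval P (+ x) (+ y))
Polynomial-eval []              = const 0ℤ
Polynomial-eval ((c , a , b) ∷ P) =
  const c *ₚ Polynomial-^ varˣ a *ₚ Polynomial-^ varʸ b +ₚ Polynomial-eval P

exponentBound : Poly → ℕ
exponentBound []              = 0
exponentBound ((c , a , b) ∷ P) = suc a ℕ.⊔ suc b ℕ.⊔ exponentBound P

∑-select : ∀ D p b c (f : ℕ → ℤ) → b ℕ.< D →
           ∑[ j < D ] ((if p ∧ (b ≡ᵇ j) then c else 0ℤ) * f j) ≡ (if p then c else 0ℤ) * f b
∑-select D true  b c f b<D = ∑-indicator D b c f b<D
∑-select D false b c f b<D = trans (trans (∑-cong D λ j → *-zeroˡ (f j)) (∑-zero D)) (sym (*-zeroˡ (f b)))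

eval≡∑coeff : ∀ P D → exponentBound P ℕ.≤ D → ∀ X Y →
              eval P X Y ≡ ∑[ i < D ] ∑[ j < D ] (coeff P i j * (X ℤ.^ i * Y ℤ.^ j))
eval≡∑coeff []              D _ X Y =
  sym (trans (∑-cong D λ i → trans (∑-cong D λ j → *-zeroˡ (X ℤ.^ i * Y ℤ.^ j)) (∑-zero D)) (∑-zero D))
eval≡∑coeff ((c , a , b) ∷ P) D bound X Y = begin
  c * X ℤ.^ a * Y ℤ.^ b + eval P X Y
    ≡⟨ cong₂ _+_ (sym monomial) (eval≡∑coeff P D (ℕ.m⊔n≤o⇒n≤o _ (exponentBound P) bound) X Y) ⟩
  ∑[ i < D ] ∑[ j < D ] (δ i j * m i j) + ∑[ i < D ] ∑[ j < D ] (coeff P i j * m i j)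
    ≡⟨ ∑-distrib-+ D _ _ ⟨
  ∑[ i < D ] (∑[ j < D ] (δ i j * m i j) + ∑[ j < D ] (coeff P i j * m i j))
    ≡⟨ ∑-cong D (λ i → sym (∑-distrib-+ D _ _)) ⟩
  ∑[ i < D ] ∑[ j < D ] (δ i j * m i j + coeff P i j * m i j)
    ≡⟨ ∑-cong D (λ i → ∑-cong D λ j → sym (*-distribʳ-+ (m i j) (δ i j) (coeff P i j))) ⟩
  ∑[ i < D ] ∑[ j < D ] (coeff ((c , a , b) ∷ P) i j * m i j) ∎
  where
  open ≡-Reasoning
  δ : ℕ → ℕ → ℤ
  δ i j = if (a ≡ᵇ i) ∧ (b ≡ᵇ j) then c else 0ℤ
  m : ℕ → ℕ → ℤ
  m i j = X ℤ.^ i * Y ℤ.^ j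
  a<D : a ℕ.< D
  a<D = ℕ.m⊔n≤o⇒m≤o (suc a) (suc b) (ℕ.m⊔n≤o⇒m≤o (suc a ℕ.⊔ suc b) (exponentBound P) bound)
  b<D : b ℕ.< D
  b<D = ℕ.m⊔n≤o⇒n≤o (suc a) (suc b) (ℕ.m⊔n≤o⇒m≤o (suc a ℕ.⊔ suc b) (exponentBound P) bound)
  monomial : ∑[ i < D ] ∑[ j < D ] (δ i j * m i j) ≡ c * X ℤ.^ a * Y ℤ.^ b
  monomial = begin
    ∑[ i < D ] ∑[ j < D ] (δ i j * m i j)
      ≡⟨ ∑-cong D (λ i → ∑-select D (a ≡ᵇ i) b c (m i) b<D) ⟩
    ∑[ i < D ] ((if a ≡ᵇ i then c else 0ℤ) * m i b)
      ≡⟨ ∑-indicator D a c (λ i → m i b) a<D ⟩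
    c * (X ℤ.^ a * Y ℤ.^ b)                            ≡⟨ *-assoc c _ _ ⟨
    c * X ℤ.^ a * Y ℤ.^ b                              ∎

eval-swap : ∀ P → Symmetric P → ∀ X Y → eval P X Y ≡ eval P Y X
eval-swap P P-sym X Y = begin
  eval P X Y
    ≡⟨ eval≡∑coeff P D ℕ.≤-refl X Y ⟩
  ∑[ i < D ] ∑[ j < D ] (coeff P i j * (X ℤ.^ i * Y ℤ.^ j))
    ≡⟨ ∑-cong D (λ i → ∑-cong D λ j → cong₂ _*_ (P-sym i j) (*-comm (X ℤ.^ i) (Y ℤ.^ j))) ⟩
  ∑[ i < D ] ∑[ j < D ] (coeff P j i * (Y ℤ.^ j * X ℤ.^ i))
    ≡⟨ ∑-comm D D _ ⟩
  ∑[ j < D ] ∑[ i < D ] (coeff P j i * (Y ℤ.^ j * X ℤ.^ i))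
    ≡⟨ eval≡∑coeff P D ℕ.≤-refl Y X ⟨
  eval P Y X ∎
  where
  open ≡-Reasoning
  D = exponentBound P

-- Sums over the pairs of a given type

∑Type : Word → (ℕ → ℕ → ℤ) → ℤ
∑Type T G = ∑[ x < 2 ^ length T ] ∑[ y < 2 ^ length T ] (if hasType T x y then G x y else 0ℤ)

∑Type-cong : ∀ T {G H : ℕ → ℕ → ℤ} → (∀ x y → G x y ≡ H x y) → ∑Type T G ≡ ∑Type T H
∑Type-cong T G≗H =
  ∑-cong N λ x → ∑-cong N λ y → cong (λ z → if hasType T x y then z else 0ℤ) (G≗H x y)
  where N = 2 ^ length T

∑Type-+ : ∀ T (G H : ℕ → ℕ → ℤ) → ∑Type T (λ x y → G x y + H x y) ≡ ∑Type T G + ∑Type T H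
∑Type-+ T G H = trans (∑-cong N λ x → trans (∑-cong N λ y → if-+ (hasType T x y)) (∑-distrib-+ N _ _))
                      (∑-distrib-+ N _ _)
  where
  N = 2 ^ length T
  if-+ : ∀ {g h} b → (if b then g + h else 0ℤ) ≡ (if b then g else 0ℤ) + (if b then h else 0ℤ)
  if-+ true  = refl
  if-+ false = refl

∑Type-*ˡ : ∀ T c (G : ℕ → ℕ → ℤ) → ∑Type T (λ x y → c * G x y) ≡ c * ∑Type T G
∑Type-*ˡ T c G = trans (∑-cong N λ x → trans (∑-cong N λ y → if-* (hasType T x y)) (∑-distribˡ-* N c _))
                       (∑-distribˡ-* N c _)
  where
  N = 2 ^ length T
  if-* : ∀ {g} b → (if b then c * g else 0ℤ) ≡ c * (if b then g else 0ℤ)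
  if-* true  = refl
  if-* false = sym (*-zeroʳ c)

letterOK-sym : ∀ l a b → letterOK l a b ≡ letterOK l b a
letterOK-sym Z a b = ∧-comm (a ≡ᵇ 0) (b ≡ᵇ 0)
letterOK-sym O a b = ∧-comm (a ≡ᵇ 1) (b ≡ᵇ 1)
letterOK-sym M a b = cong (_≡ᵇ 1) (ℕ.+-comm a b)

hasType-sym : ∀ T x y → hasType T x y ≡ hasType T y x
hasType-sym []      x y = refl
hasType-sym (l ∷ T) x y = cong₂ _∧_ (letterOK-sym l _ _) (hasType-sym T x y)

∑Type-swap : ∀ T (G : ℕ → ℕ → ℤ) → ∑Type T (λ x y → G y x) ≡ ∑Type T G
∑Type-swap T G =
  trans (∑-cong N λ x → ∑-cong N λ y → cong (λ b → if b then G y x else 0ℤ) (hasType-sym T x y))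
        (∑-comm N N λ x y → if hasType T y x then G y x else 0ℤ)
  where N = 2 ^ length T

length-∷ʳ : ∀ (T : Word) l → length (T ∷ʳ l) ≡ suc (length T)
length-∷ʳ T l = trans (length-++ T) (ℕ.+-comm (length T) 1)

hasType-∷ʳ : ∀ T l a b x y → a ℕ.< 2 → b ℕ.< 2 →
             hasType (T ∷ʳ l) (a ℕ.+ 2 ℕ.* x) (b ℕ.+ 2 ℕ.* y) ≡ hasType T x y ∧ letterOK l a b
hasType-∷ʳ [] l a b x y a<2 b<2 =
  trans (∧-identityʳ _) (cong₂ (letterOK l) (digit-%2 a x a<2) (digit-%2 b y b<2))
hasType-∷ʳ (l′ ∷ T) l a b x y a<2 b<2 = begin
  column (length (T ∷ʳ l)) u v ∧ hasType (T ∷ʳ l) u v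
    ≡⟨ cong (λ L → column L u v ∧ hasType (T ∷ʳ l) u v) (length-∷ʳ T l) ⟩
  column L (u ℕ./ 2) (v ℕ./ 2) ∧ hasType (T ∷ʳ l) u v
    ≡⟨ cong₂ (λ x′ y′ → column L x′ y′ ∧ hasType (T ∷ʳ l) u v) (digit-/2 a x a<2) (digit-/2 b y b<2) ⟩
  column L x y ∧ hasType (T ∷ʳ l) u v
    ≡⟨ cong (column L x y ∧_) (hasType-∷ʳ T l a b x y a<2 b<2) ⟩
  column L x y ∧ (hasType T x y ∧ letterOK l a b)
    ≡⟨ ∧-assoc (column L x y) (hasType T x y) (letterOK l a b) ⟨
  hasType (l′ ∷ T) x y ∧ letterOK l a b ∎
  where
  open ≡-Reasoning
  L = length T
  u = a ℕ.+ 2 ℕ.* x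
  v = b ℕ.+ 2 ℕ.* y
  column : ℕ → ℕ → ℕ → Bool
  column L x y = letterOK l′ (bit x L) (bit y L)

peel : Letter → (ℕ → ℕ → ℤ) → ℕ → ℕ → ℤ
peel Z G x y = G (2 ℕ.* x) (2 ℕ.* y)
peel O G x y = G (suc (2 ℕ.* x)) (suc (2 ℕ.* y))
peel M G x y = G (2 ℕ.* x) (suc (2 ℕ.* y)) + G (suc (2 ℕ.* x)) (2 ℕ.* y)

select-peel : ∀ l b (G : ℕ → ℕ → ℤ) x y →
  let g : ℕ → ℕ → ℤ
      g a a′ = if b ∧ letterOK l a a′ then G (a ℕ.+ 2 ℕ.* x) (a′ ℕ.+ 2 ℕ.* y) else 0ℤ
  in g 0 0 + g 0 1 + (g 1 0 + g 1 1) ≡ (if b then peel l G x y else 0ℤ)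
select-peel l false G x y = refl
select-peel Z true  G x y = trans (+-identityʳ _) (+-identityʳ _)
select-peel O true  G x y = trans (+-identityˡ _) (+-identityˡ _)
select-peel M true  G x y =
  cong₂ _+_ (+-identityˡ (G (2 ℕ.* x) (suc (2 ℕ.* y)))) (+-identityʳ (G (suc (2 ℕ.* x)) (2 ℕ.* y)))

∑Type-∷ʳ : ∀ T l (G : ℕ → ℕ → ℤ) → ∑Type (T ∷ʳ l) G ≡ ∑Type T (peel l G)
∑Type-∷ʳ T l G = begin
  ∑Type (T ∷ʳ l) G
    ≡⟨ cong (λ L → ∑[ x < 2 ^ L ] ∑[ y < 2 ^ L ] F x y) (length-∷ʳ T l) ⟩
  ∑[ x < 2 ℕ.* N ] ∑[ y < 2 ℕ.* N ] F x y
    ≡⟨ ∑-double N _ ⟩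
  ∑[ x < N ] (∑[ y < 2 ℕ.* N ] F (2 ℕ.* x) y + ∑[ y < 2 ℕ.* N ] F (suc (2 ℕ.* x)) y)
    ≡⟨ ∑-cong N (λ x → cong₂ _+_ (∑-double N _) (∑-double N _)) ⟩
  ∑[ x < N ] (∑[ y < N ] (F (2 ℕ.* x) (2 ℕ.* y) + F (2 ℕ.* x) (suc (2 ℕ.* y)))
              + ∑[ y < N ] (F (suc (2 ℕ.* x)) (2 ℕ.* y) + F (suc (2 ℕ.* x)) (suc (2 ℕ.* y))))
    ≡⟨ ∑-cong N (λ x → sym (∑-distrib-+ N _ _)) ⟩
  ∑[ x < N ] ∑[ y < N ] (F (2 ℕ.* x) (2 ℕ.* y) + F (2 ℕ.* x) (suc (2 ℕ.* y))
                         + (F (suc (2 ℕ.* x)) (2 ℕ.* y) + F (suc (2 ℕ.* x)) (suc (2 ℕ.* y))))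
    ≡⟨ ∑-cong N (λ x → ∑-cong N (λ y → peel-cell x y)) ⟩
  ∑Type T (peel l G) ∎
  where
  open ≡-Reasoning
  N = 2 ^ length T
  F : ℕ → ℕ → ℤ
  F x y = if hasType (T ∷ʳ l) x y then G x y else 0ℤ
  cell : ∀ a a′ x y → a ℕ.< 2 → a′ ℕ.< 2 →
         F (a ℕ.+ 2 ℕ.* x) (a′ ℕ.+ 2 ℕ.* y)
           ≡ (if hasType T x y ∧ letterOK l a a′ then G (a ℕ.+ 2 ℕ.* x) (a′ ℕ.+ 2 ℕ.* y) else 0ℤ)
  cell a a′ x y a<2 a′<2 =
    cong (λ b → if b then G (a ℕ.+ 2 ℕ.* x) (a′ ℕ.+ 2 ℕ.* y) else 0ℤ) (hasType-∷ʳ T l a a′ x y a<2 a′<2)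
  0<2 : 0 ℕ.< 2
  0<2 = ℕ.s≤s ℕ.z≤n
  1<2 : 1 ℕ.< 2
  1<2 = ℕ.s≤s (ℕ.s≤s ℕ.z≤n)
  peel-cell : ∀ x y → F (2 ℕ.* x) (2 ℕ.* y) + F (2 ℕ.* x) (suc (2 ℕ.* y))
                      + (F (suc (2 ℕ.* x)) (2 ℕ.* y) + F (suc (2 ℕ.* x)) (suc (2 ℕ.* y)))
                      ≡ (if hasType T x y then peel l G x y else 0ℤ)
  peel-cell x y = trans (cong₂ _+_ (cong₂ _+_ (cell 0 0 x y 0<2 0<2) (cell 0 1 x y 0<2 1<2))
                                   (cong₂ _+_ (cell 1 0 x y 1<2 0<2) (cell 1 1 x y 1<2 1<2)))
                        (select-peel l (hasType T x y) G x y)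

sumℤ : List ℤ → ℤ
sumℤ = foldr _+_ 0ℤ

sumℤ-++ : ∀ xs ys → sumℤ (xs ++ ys) ≡ sumℤ xs + sumℤ ys
sumℤ-++ []       ys = sym (+-identityˡ _)
sumℤ-++ (x ∷ xs) ys = trans (cong (_+_ x) (sumℤ-++ xs ys)) (sym (+-assoc x _ _))

sumℤ-filter : ∀ {A : Set} (q : A → Bool) (g : A → ℤ) xs →
              sumℤ (map g (filter (λ a → T? (q a)) xs)) ≡ sumℤ (map (λ a → if q a then g a else 0ℤ) xs)
sumℤ-filter q g []       = refl
sumℤ-filter q g (a ∷ xs) with q a
... | true  = cong (_+_ (g a)) (sumℤ-filter q g xs)
... | false = trans (sumℤ-filter q g xs) (sym (+-identityˡ _))

sumℤ-concatMap : ∀ {A B : Set} (f : A → List B) (g : B → ℤ) xs →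
                 sumℤ (map g (concatMap f xs)) ≡ sumℤ (map (λ a → sumℤ (map g (f a))) xs)
sumℤ-concatMap f g []       = refl
sumℤ-concatMap f g (a ∷ xs) =
  trans (cong sumℤ (map-++ g (f a) (concatMap f xs)))
        (trans (sumℤ-++ (map g (f a)) _) (cong (_+_ (sumℤ (map g (f a)))) (sumℤ-concatMap f g xs)))

sumℤ-applyUpTo : ∀ n (f : ℕ → ℕ) (h : ℕ → ℤ) → sumℤ (map h (applyUpTo f n)) ≡ ∑[ i < n ] h (f i)
sumℤ-applyUpTo zero    f h = refl
sumℤ-applyUpTo (suc n) f h = cong (_+_ (h (f 0))) (sumℤ-applyUpTo n (f ∘ suc) h)

𝔖≡∑Type : ∀ {n} (e : Vec ℕ n) T P → 𝔖 e T P ≡ ∑Type T (λ x y → eval P (+ x) (+ y) * + weight e x y)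
𝔖≡∑Type e T P = begin
  𝔖 e T P
    ≡⟨ sumℤ-filter (λ p → hasType T (proj₁ p) (proj₂ p)) (uncurry G) (allPairs (length T)) ⟩
  sumℤ (map G⁰ (concatMap (λ x → map (x ,_) (upTo N)) (upTo N)))
    ≡⟨ sumℤ-concatMap (λ x → map (x ,_) (upTo N)) G⁰ (upTo N) ⟩
  sumℤ (map (λ x → sumℤ (map G⁰ (map (x ,_) (upTo N)))) (upTo N))
    ≡⟨ sumℤ-applyUpTo N id _ ⟩
  ∑[ x < N ] sumℤ (map G⁰ (map (x ,_) (upTo N)))
    ≡⟨ ∑-cong N (λ x → trans (cong sumℤ (sym (map-∘ (upTo N)))) (sumℤ-applyUpTo N id _)) ⟩
  ∑Type T G ∎
  where
  open ≡-Reasoning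
  N = 2 ^ length T
  G : ℕ → ℕ → ℤ
  G x y = eval P (+ x) (+ y) * + weight e x y
  G⁰ : ℕ × ℕ → ℤ
  G⁰ (x , y) = if hasType T x y then G x y else 0ℤ

countM-++ : ∀ T U → countM (T ++ U) ≡ countM T ℕ.+ countM U
countM-++ []      U = refl
countM-++ (Z ∷ T) U = countM-++ T U
countM-++ (O ∷ T) U = countM-++ T U
countM-++ (M ∷ T) U = cong suc (countM-++ T U)

countM-∷ʳ : ∀ T l → countM (T ∷ʳ l) ≡ countM (l ∷ T)
countM-∷ʳ T Z = trans (countM-++ T (Z ∷ [])) (ℕ.+-identityʳ _)
countM-∷ʳ T O = trans (countM-++ T (O ∷ [])) (ℕ.+-identityʳ _)
countM-∷ʳ T M = trans (countM-++ T (M ∷ [])) (ℕ.+-comm _ 1)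

SymmetricFn : (ℕ → ℕ → ℤ) → Set
SymmetricFn R = ∀ x y → R x y ≡ R y x

module WeightedSums
  (W φ : ℕ → ℕ → ℤ)
  (W-double   : ∀ i x → W i (2 ℕ.* x) ≡ W (suc i) x)
  (W-double+1 : ∀ i x → W i (suc (2 ℕ.* x)) ≡ W (suc i) x * φ i x)
  (φ-constantMod2 : ∀ i → ConstantMod2 (λ x _ → φ i x))
  where

  weighted : ℕ → (ℕ → ℕ → ℤ) → ℕ → ℕ → ℤ
  weighted i R x y = R x y * W i x * W i y

  weighted-swap : ∀ i R x y → weighted i R y x ≡ weighted i (λ a b → R b a) x y
  weighted-swap i R x y = *-right-comm (R y x) (W i y) (W i x)

  weighted-sym : ∀ i {R} → SymmetricFn R → SymmetricFn (weighted i R)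
  weighted-sym i {R} R-sym x y =
    sym (trans (weighted-swap i R x y) (cong (λ r → r * W i x * W i y) (sym (R-sym x y))))

  Divisible : Word → Set
  Divisible T = ∀ i {R} → Polynomial R → SymmetricFn R → + (2 ^ countM T) ∣ₛ ∑Type T (weighted i R)

  module _ {T} (divisible-T : Divisible T) where

    -- Twice the sum of any polynomial is the sum of its symmetrisation.
    ∣-double-∑Type : ∀ i {R} → Polynomial R → + (2 ^ countM T) ∣ₛ + 2 * ∑Type T (weighted i R)
    ∣-double-∑Type i {R} R-poly = subst (_ ∣ₛ_) symmetrise
      (divisible-T i (R-poly +ₚ Polynomial-swap R-poly) (λ x y → +-comm (R x y) (R y x)))
      where
      open ≡-Reasoning
      G = weighted i R
      distrib : ∀ x y → weighted i (λ a b → R a b + R b a) x y ≡ G x y + G y x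
      distrib x y = trans (*-distribʳ-+-twice (R x y) (R y x) (W i x) (W i y))
                          (cong (_+_ (G x y)) (sym (weighted-swap i R x y)))
        where
        *-distribʳ-+-twice : ∀ r s a b → (r + s) * a * b ≡ r * a * b + s * a * b
        *-distribʳ-+-twice = solve-∀
      symmetrise : ∑Type T (weighted i (λ x y → R x y + R y x)) ≡ + 2 * ∑Type T G
      symmetrise = begin
        ∑Type T (weighted i (λ x y → R x y + R y x))    ≡⟨ ∑Type-cong T distrib ⟩
        ∑Type T (λ x y → G x y + G y x)                 ≡⟨ ∑Type-+ T G (λ x y → G y x) ⟩
        ∑Type T G + ∑Type T (λ x y → G y x)             ≡⟨ cong (_+_ (∑Type T G)) (∑Type-swap T G) ⟩
        ∑Type T G + ∑Type T G                           ≡⟨ double (∑Type T G) ⟩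
        + 2 * ∑Type T G                                 ∎
        where
        double : ∀ a → a + a ≡ + 2 * a
        double = solve-∀

    ∣-∑Type-constantMod2 : ∀ i {Q} → ConstantMod2 Q → + (2 ^ countM T) ∣ₛ ∑Type T (weighted i Q)
    ∣-∑Type-constantMod2 i {Q} Q≡ = subst (_ ∣ₛ_) (sym split)
      (∣m∣n⇒∣m+n (divisible-T i (const c) (λ _ _ → refl)) (∣-double-∑Type i (quotient-polynomial Q≡)))
      where
      open ≡-Reasoning
      c = constant Q≡
      q = quotient Q≡
      expand : ∀ x y → weighted i Q x y ≡ weighted i (λ _ _ → c) x y + + 2 * weighted i q x y
      expand x y = trans (cong (λ z → z * W i x * W i y) (decomposition Q≡ x y))
                         (distrib c (q x y) (W i x) (W i y))
        where
        distrib : ∀ c q a b → (c + + 2 * q) * a * b ≡ c * a * b + + 2 * (q * a * b)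
        distrib = solve-∀
      split : ∑Type T (weighted i Q) ≡ ∑Type T (weighted i (λ _ _ → c)) + + 2 * ∑Type T (weighted i q)
      split = begin
        ∑Type T (weighted i Q)
          ≡⟨ ∑Type-cong T expand ⟩
        ∑Type T (λ x y → weighted i (λ _ _ → c) x y + + 2 * weighted i q x y)
          ≡⟨ ∑Type-+ T _ _ ⟩
        ∑Type T (weighted i (λ _ _ → c)) + ∑Type T (λ x y → + 2 * weighted i q x y)
          ≡⟨ cong (_+_ (∑Type T (weighted i (λ _ _ → c)))) (∑Type-*ˡ T (+ 2) (weighted i q)) ⟩
        ∑Type T (weighted i (λ _ _ → c)) + + 2 * ∑Type T (weighted i q) ∎

    peelZ-divisible : ∀ i {R} → Polynomial R → SymmetricFn R →
                      + (2 ^ countM T) ∣ₛ ∑Type T (peel Z (weighted i R))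
    peelZ-divisible i {R} R-poly R-sym =
      subst (_ ∣ₛ_) (∑Type-cong T λ x y → sym (regroup x y))
        (divisible-T (suc i) (ConstantMod2⇒Polynomial (Polynomial-dilate R-poly 0 0)) (λ x y → R-sym _ _))
      where
      regroup : ∀ x y → peel Z (weighted i R) x y ≡ weighted (suc i) (λ a b → R (2 ℕ.* a) (2 ℕ.* b)) x y
      regroup x y = cong₂ (λ a b → R (2 ℕ.* x) (2 ℕ.* y) * a * b) (W-double i x) (W-double i y)

    peelO-divisible : ∀ i {R} → Polynomial R → SymmetricFn R →
                      + (2 ^ countM T) ∣ₛ ∑Type T (peel O (weighted i R))
    peelO-divisible i {R} R-poly R-sym =
      subst (_ ∣ₛ_) (∑Type-cong T λ x y → sym (regroup x y)) (divisible-T (suc i) R₁-poly R₁-sym)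
      where
      R₁ : ℕ → ℕ → ℤ
      R₁ x y = R (suc (2 ℕ.* x)) (suc (2 ℕ.* y)) * φ i x * φ i y
      R₁-poly : Polynomial R₁
      R₁-poly = ConstantMod2⇒Polynomial
        (ConstantMod2-* (ConstantMod2-* (Polynomial-dilate R-poly 1 1) (φ-constantMod2 i))
                        (ConstantMod2-swap (φ-constantMod2 i)))
      R₁-sym : SymmetricFn R₁
      R₁-sym x y = trans (cong (λ r → r * φ i x * φ i y) (R-sym _ _))
                         (*-right-comm (R (suc (2 ℕ.* y)) (suc (2 ℕ.* x))) (φ i x) (φ i y))
      regroup : ∀ x y → peel O (weighted i R) x y ≡ weighted (suc i) R₁ x y
      regroup x y =
        trans (cong₂ (λ a b → r * a * b) (W-double+1 i x) (W-double+1 i y))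
              (pull-out r (W (suc i) x) (φ i x) (W (suc i) y) (φ i y))
        where
        r = R (suc (2 ℕ.* x)) (suc (2 ℕ.* y))
        pull-out : ∀ r w f w′ f′ → r * (w * f) * (w′ * f′) ≡ r * f * f′ * w * w′
        pull-out = solve-∀

    -- By symmetry the cells (2x, 2y+1) and (2x+1, 2y) contribute equally.
    peelM-divisible : ∀ i {R} → Polynomial R → SymmetricFn R →
                      + (2 ^ suc (countM T)) ∣ₛ ∑Type T (peel M (weighted i R))
    peelM-divisible i {R} R-poly R-sym =
      subst₂ _∣ₛ_ (sym (pos-* 2 (2 ^ countM T))) (sym peel≡2∑)
             (*-monoʳ-∣ (+ 2) (∣-∑Type-constantMod2 (suc i) Q≡))
      where
      open ≡-Reasoning
      G = weighted i R
      H : ℕ → ℕ → ℤ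
      H x y = G (2 ℕ.* x) (suc (2 ℕ.* y))
      Q : ℕ → ℕ → ℤ
      Q x y = R (2 ℕ.* x) (suc (2 ℕ.* y)) * φ i y
      Q≡ : ConstantMod2 Q
      Q≡ = ConstantMod2-* (Polynomial-dilate R-poly 0 1) (ConstantMod2-swap (φ-constantMod2 i))
      H≡ : ∀ x y → H x y ≡ weighted (suc i) Q x y
      H≡ x y = trans (cong₂ (λ a b → r * a * b) (W-double i x) (W-double+1 i y))
                     (regroup r (W (suc i) x) (W (suc i) y) (φ i y))
        where
        r = R (2 ℕ.* x) (suc (2 ℕ.* y))
        regroup : ∀ r w w′ f → r * w * (w′ * f) ≡ r * f * w * w′
        regroup = solve-∀
      peel≡2∑ : ∑Type T (peel M G) ≡ + 2 * ∑Type T (weighted (suc i) Q)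
      peel≡2∑ = begin
        ∑Type T (peel M G)
          ≡⟨ ∑Type-+ T H (λ x y → G (suc (2 ℕ.* x)) (2 ℕ.* y)) ⟩
        ∑Type T H + ∑Type T (λ x y → G (suc (2 ℕ.* x)) (2 ℕ.* y))
          ≡⟨ cong (_+_ (∑Type T H)) (trans (∑Type-cong T λ _ _ → weighted-sym i R-sym _ _) (∑Type-swap T H)) ⟩
        ∑Type T H + ∑Type T H
          ≡⟨ double (∑Type T H) ⟩
        + 2 * ∑Type T H
          ≡⟨ cong (+ 2 *_) (∑Type-cong T H≡) ⟩
        + 2 * ∑Type T (weighted (suc i) Q) ∎
        where
        double : ∀ a → a + a ≡ + 2 * a
        double = solve-∀

    divisible-∷ʳ : ∀ l → Divisible (T ∷ʳ l)
    divisible-∷ʳ l i {R} R-poly R-sym =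
      subst₂ (λ m s → + (2 ^ m) ∣ₛ s) (sym (countM-∷ʳ T l)) (sym (∑Type-∷ʳ T l _)) (peel-divisible l)
      where
      peel-divisible : ∀ l → + (2 ^ countM (l ∷ T)) ∣ₛ ∑Type T (peel l (weighted i R))
      peel-divisible Z = peelZ-divisible i R-poly R-sym
      peel-divisible O = peelO-divisible i R-poly R-sym
      peel-divisible M = peelM-divisible i R-poly R-sym

  divisible : ∀ T → Divisible T
  divisible T = by-suffix (reverseView T)
    where
    by-suffix : ∀ {T} → Reverse T → Divisible T
    by-suffix []             i {R} _ _ = divides (∑Type [] (weighted i R)) (sym (*-identityʳ _))
    by-suffix (T ∶ r ∶ʳ l) = divisible-∷ʳ {T} (by-suffix r) l

-- Weights built from odd parts of factorials

Θ₂-offset-constantMod2 : ∀ k s → suc s ℕ.≤ 2 ^ k →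
                         ConstantMod2 (λ x _ → + Θ₂ (suc (2 ^ suc k ℕ.* x ℕ.+ s)))
Θ₂-offset-constantMod2 k s s<2^k with Θ₂-offset k s s<2^k
... | r , j , Θ₂≡ = record
  { constant = + o ; quotient = λ x _ → + (2 ^ r) * + x
  ; quotient-polynomial = const (+ (2 ^ r)) *ₚ varˣ
  ; decomposition = λ x _ → begin
      + Θ₂ (suc (2 ^ suc k ℕ.* x ℕ.+ s))   ≡⟨ cong +_ (Θ₂≡ x) ⟩
      + (o ℕ.+ 2 ℕ.* (2 ^ r ℕ.* x))       ≡⟨ pos-+ o _ ⟩
      + o + + (2 ℕ.* (2 ^ r ℕ.* x))       ≡⟨ cong (_+_ (+ o)) (trans (pos-* 2 (2 ^ r ℕ.* x)) (cong (+ 2 *_) (pos-* (2 ^ r) x))) ⟩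
      + o + + 2 * (+ (2 ^ r) * + x)       ∎ }
  where
  open ≡-Reasoning
  o = suc (2 ℕ.* j)

ConstantMod2-pos-* : ∀ {f g : ℕ → ℕ → ℕ} →
                     ConstantMod2 (λ x y → + f x y) → ConstantMod2 (λ x y → + g x y) →
                     ConstantMod2 (λ x y → + (f x y ℕ.* g x y))
ConstantMod2-pos-* {f} {g} f≡ g≡ =
  ConstantMod2-resp (λ x y → sym (pos-* (f x y) (g x y))) (ConstantMod2-* f≡ g≡)

ConstantMod2-pos-^ : ∀ {f : ℕ → ℕ → ℕ} → ConstantMod2 (λ x y → + f x y) →
                     ∀ n → ConstantMod2 (λ x y → + (f x y ^ n))
ConstantMod2-pos-^ f≡ zero    = ConstantMod2-const (+ 1)
ConstantMod2-pos-^ f≡ (suc n) = ConstantMod2-pos-* f≡ (ConstantMod2-pos-^ f≡ n)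

oddPartProduct-constantMod2 : ∀ k t → t ℕ.≤ 2 ^ k →
                              ConstantMod2 (λ x _ → + oddPartProduct (2 ^ suc k ℕ.* x) t)
oddPartProduct-constantMod2 k zero    _      = ConstantMod2-const (+ 1)
oddPartProduct-constantMod2 k (suc t) t<2^k  =
  ConstantMod2-pos-* (Θ₂-offset-constantMod2 k t t<2^k) (oddPartProduct-constantMod2 k t (ℕ.<⇒≤ t<2^k))

oddRatio-constantMod2 : ∀ {n} i (e : Vec ℕ n) → ConstantMod2 (λ x _ → + oddRatio i e x)
oddRatio-constantMod2 i []      = ConstantMod2-const (+ 1)
oddRatio-constantMod2 i (a ∷ e) =
  ConstantMod2-pos-* (ConstantMod2-pos-^ (oddPartProduct-constantMod2 i (2 ^ i) ℕ.≤-refl) a)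
                     (oddRatio-constantMod2 (suc i) e)

module OddPartWeights {n} (e : Vec ℕ n) = WeightedSums
  (λ i x → + weight₁ i e x) (λ i x → + oddRatio i e x)
  (λ i x → cong +_ (weight₁-double i e x))
  (λ i x → trans (cong +_ (weight₁-double+1 i e x)) (pos-* (weight₁ (suc i) e x) (oddRatio i e x)))
  (λ i → oddRatio-constantMod2 i e)

𝔖≡∑Type-weighted : ∀ {n} (e : Vec ℕ n) T P →
                   𝔖 e T P ≡ ∑Type T (OddPartWeights.weighted e 0 (λ x y → eval P (+ x) (+ y)))
𝔖≡∑Type-weighted e T P = trans (𝔖≡∑Type e T P) (∑Type-cong T λ x y → begin
  R x y * + weight e x y                            ≡⟨ cong (λ w → R x y * + w) (weightFrom-split 0 e x y) ⟩
  R x y * + (weight₁ 0 e x ℕ.* weight₁ 0 e y)       ≡⟨ cong (R x y *_) (pos-* (weight₁ 0 e x) _) ⟩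
  R x y * (+ weight₁ 0 e x * + weight₁ 0 e y)       ≡⟨ *-assoc (R x y) _ _ ⟨
  OddPartWeights.weighted e 0 R x y                 ∎)
  where
  open ≡-Reasoning
  R : ℕ → ℕ → ℤ
  R x y = eval P (+ x) (+ y)

lemma3 : (P : Poly) → Symmetric P → (k : ℕ) (e : Vec ℕ (suc k)) (T : Word) →
         (+ (2 ^ countM T)) ∣ 𝔖 e T P
lemma3 P P-sym k e T = ∣⇒∣ᵤ (subst (_ ∣ₛ_) (sym (𝔖≡∑Type-weighted e T P))
  (OddPartWeights.divisible e T 0 (Polynomial-eval P) (λ x y → eval-swap P P-sym (+ x) (+ y))))
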